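{- Let $m_1$ and $m_2$ be positive integers. If there is a positive integer $k$ such that $m_1=km_2+k-1$, then $\chi'_g(G;m_1,1)\le \chi'_g(G;m_2,1)$ for every finite simple graph $G$. In particular, if $m_1$ is odd, then $\chi'_g(G;m_1,1)\le \chi'_g(G;1,1)=\chi'_g(G)$ for every finite simple graph $G$.
   Context: The $(m,1)$-edge coloring game on a finite simple graph $G$ with a set of colors $X$ is played alternately by two players, Maker and Breaker, with Maker playing first. On each turn Maker makes $m$ moves and Breaker makes one move; a move consists of coloring one uncolored edge of $G$ with a color from $X$ so that adjacent edges (edges sharing an endpoint) always receive distinct colors. Maker wins if eventually every edge is colored; Breaker wins if at some point the player who is to move cannot color any edge. The $(m,1)$-game chromatic index $\chi'_g(G;m,1)$ is the smallest nonnegative integer $k$ such that Maker has a winning strategy when $|X|=k$. The game chromatic index $\chi'_g(G)$ is $\chi'_g(G;1,1)$. -}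

module Defs where

open import Data.Nat using (ℕ; zero; suc; pred) renaming (_<_ to _<ℕ_)
open import Data.Fin using (Fin; _<_; _≟_)
open import Data.Bool using (Bool; true; false; _∧_; if_then_else_)
open import Data.Maybe using (Maybe; just; nothing)
open import Data.Product using (Σ; ∃; ∃-syntax; _×_; _,_)
open import Data.Sum using (_⊎_)
open import Relation.Nullary using (¬_)
open import Relation.Nullary.Decidable using (⌊_⌋)
open import Relation.Binary.PropositionalEquality using (_≡_; _≢_)

record Graph : Set where
  field
    n      : ℕ
    adj    : Fin n → Fin n → Bool
    sym    : ∀ i j → adj i j ≡ adj j i
    irrefl : ∀ i → adj i i ≡ false
open Graph public

-- The edge {u,v} is represented by the ordered pair (u,v) with u < v.
Edge : (G : Graph) → Fin (n G) → Fin (n G) → Set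
Edge G u v = (u < v) × (adj G u v ≡ true)

Coloring : Graph → ℕ → Set
Coloring G k = Fin (n G) → Fin (n G) → Maybe (Fin k)

empty : (G : Graph) (k : ℕ) → Coloring G k
empty G k _ _ = nothing

ShareEnd : {N : ℕ} → Fin N → Fin N → Fin N → Fin N → Set
ShareEnd u v x y = (x ≡ u ⊎ x ≡ v) ⊎ (y ≡ u ⊎ y ≡ v)

Complete : (G : Graph) {k : ℕ} → Coloring G k → Set
Complete G c = ∀ u v → Edge G u v → ∃[ α ] (c u v ≡ just α)

Legal : (G : Graph) {k : ℕ} → Coloring G k → Fin (n G) → Fin (n G) → Fin k → Set
Legal G c u v α =
  Edge G u v × (c u v ≡ nothing) ×
  (∀ x y → Edge G x y → ShareEnd u v x y → c x y ≢ just α)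

set : (G : Graph) {k : ℕ} → Coloring G k → Fin (n G) → Fin (n G) → Fin k → Coloring G k
set G c u v α x y = if ⌊ x ≟ u ⌋ ∧ ⌊ y ≟ v ⌋ then just α else c x y

-- Whose turn it is: `maker r` = Maker moves now and has r further moves
-- in this turn; `breaker` = Breaker moves now.
data Turn : Set where
  maker   : ℕ → Turn
  breaker : Turn

afterMaker : ℕ → Turn
afterMaker zero    = breaker
afterMaker (suc r) = maker r

data MakerWins (G : Graph) (m k : ℕ) : Coloring G k → Turn → Set where
  done        : ∀ {c t} → Complete G c → MakerWins G m k c t
  makerMove   : ∀ {c r} u v α → Legal G c u v α →
                MakerWins G m k (set G c u v α) (afterMaker r) →
                MakerWins G m k c (maker r)
  breakerMove : ∀ {c} →
                (∃[ u ] ∃[ v ] ∃[ α ] Legal G c u v α) →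
                (∀ u v α → Legal G c u v α →
                   MakerWins G m k (set G c u v α) (maker (pred m))) →
                MakerWins G m k c breaker

MakerWinsGame : Graph → ℕ → ℕ → Set
MakerWinsGame G m k = MakerWins G m k (empty G k) (maker (pred m))

IsGameChromaticIndex : Graph → ℕ → ℕ → Set
IsGameChromaticIndex G m χ =
  MakerWinsGame G m χ × (∀ j → j <ℕ χ → ¬ MakerWinsGame G m j)

-- Maker with m₁ = k m₂ + (k − 1) moves per turn splits each turn into k
-- blocks of m₂ moves separated by k − 1 single moves.  During a block he
-- follows a winning strategy of the (m₂,1)-game; each separating move he
-- treats as a Breaker move of that game, choosing it himself (any legal
-- move will do, as the strategy answers every Breaker move).  The real
-- Breaker moves only after the k-th block, exactly where the simulated
-- Breaker would, so every number of colors that lets Maker win the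
-- (m₂,1)-game lets him win the (m₁,1)-game.
module Submission where

open import Defs
open import Data.Nat using (ℕ; _+_; _*_; _∸_; _≤_; zero; suc; s≤s; z≤n)
open import Data.Nat.Properties using (+-suc; ≮⇒≥)
open import Data.Nat.Tactic.RingSolver using (solve-∀)
open import Data.Product using (_×_; ∃-syntax; _,_; proj₁; proj₂)
open import Relation.Binary.PropositionalEquality using (_≡_; subst; trans)
  renaming (sym to ≡-sym)

-- The simulated game has m₂ = suc p moves per turn; the real one has
-- m₁ = suc (j₀ * block + p), i.e. k = suc j₀ blocks.
module BlockSimulation (G : Graph) (K p j₀ : ℕ) where

  block : ℕ
  block = suc (suc p)

  m₁ : ℕ
  m₁ = suc (j₀ * block + p)

  -- `Simulates t₁ t₂`: real turn t₁ corresponds to simulated turn t₂;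
  -- j counts the blocks of the current real turn still to come, each
  -- preceded by one move Maker plays for the simulated Breaker.
  data Simulates : Turn → Turn → Set where
    breaker-breaker : Simulates breaker breaker
    maker-maker     : ∀ j r → Simulates (maker (j * block + r)) (maker r)
    maker-breaker   : ∀ j → Simulates (maker (j * block + suc p)) breaker

  afterMaker-simulates : ∀ j r → Simulates (afterMaker (j * block + r)) (afterMaker r)
  afterMaker-simulates j (suc r) rewrite +-suc (j * block) r = maker-maker j r
  afterMaker-simulates zero    zero = breaker-breaker
  afterMaker-simulates (suc j) zero =
    subst (λ x → Simulates (maker x) breaker) (block-end j p) (maker-breaker j)
    where
    block-end : ∀ j p → j * suc (suc p) + suc p ≡ suc (p + j * suc (suc p) + 0)
    block-end = solve-∀

  simulate : ∀ {c t₁ t₂} → MakerWins G (suc p) K c t₂ → Simulates t₁ t₂ →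
             MakerWins G m₁ K c t₁
  simulate (done complete) _ = done complete
  simulate (makerMove u v α legal win) (maker-maker j r) =
    makerMove u v α legal (simulate win (afterMaker-simulates j r))
  simulate (breakerMove canMove win) breaker-breaker =
    breakerMove canMove (λ u v α legal → simulate (win u v α legal) (maker-maker j₀ p))
  simulate (breakerMove (u , v , α , legal) win) (maker-breaker j)
    rewrite +-suc (j * block) p =
    makerMove u v α legal (simulate (win u v α legal) (maker-maker j p))

makerWinsGame-blocks : ∀ (G : Graph) (K m k : ℕ) → 1 ≤ m → 1 ≤ k →
  MakerWinsGame G m K → MakerWinsGame G (k * m + (k ∸ 1)) K
makerWinsGame-blocks G K (suc p) (suc j₀) _ _ win =
  subst (λ m₁ → MakerWinsGame G m₁ K) (blocks-sum j₀ p)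
        (simulate win (maker-maker j₀ p))
  where
  open BlockSimulation G K p j₀
  blocks-sum : ∀ j₀ p → suc (j₀ * suc (suc p) + p) ≡ suc j₀ * suc p + j₀
  blocks-sum = solve-∀

isGameChromaticIndex-≤ : ∀ {G m χ k} → IsGameChromaticIndex G m χ →
  MakerWinsGame G m k → χ ≤ k
isGameChromaticIndex-≤ (_ , minimal) win = ≮⇒≥ (λ k<χ → minimal _ k<χ win)

isGameChromaticIndex-blocks-≤ : ∀ {G m₁ m₂ χ₁ χ₂} k → 1 ≤ m₂ → 1 ≤ k →
  m₁ ≡ k * m₂ + (k ∸ 1) →
  IsGameChromaticIndex G m₁ χ₁ → IsGameChromaticIndex G m₂ χ₂ → χ₁ ≤ χ₂
isGameChromaticIndex-blocks-≤ {G} {m₂ = m₂} {χ₂ = χ₂} k 1≤m₂ 1≤k m₁≡ index₁ index₂ =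
  isGameChromaticIndex-≤ index₁
    (subst (λ m → MakerWinsGame G m χ₂) (≡-sym m₁≡)
           (makerWinsGame-blocks G χ₂ m₂ k 1≤m₂ 1≤k (proj₁ index₂)))

odd-as-blocks : ∀ j → 2 * j + 1 ≡ suc j * 1 + j
odd-as-blocks = solve-∀

proposition5p1 :
    (∀ (m₁ m₂ : ℕ) → 1 ≤ m₁ → 1 ≤ m₂ →
      (∃[ k ] (1 ≤ k × m₁ ≡ k * m₂ + (k ∸ 1))) →
      ∀ (G : Graph) (χ₁ χ₂ : ℕ) →
      IsGameChromaticIndex G m₁ χ₁ → IsGameChromaticIndex G m₂ χ₂ → χ₁ ≤ χ₂)
    ×
    (∀ (m₁ : ℕ) → 1 ≤ m₁ → (∃[ j ] (m₁ ≡ 2 * j + 1)) →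
      ∀ (G : Graph) (χ₁ χ₂ : ℕ) →
      IsGameChromaticIndex G m₁ χ₁ → IsGameChromaticIndex G 1 χ₂ → χ₁ ≤ χ₂)
proposition5p1 =
  (λ { _ _ _ 1≤m₂ (k , 1≤k , m₁≡) _ _ _ →
         isGameChromaticIndex-blocks-≤ k 1≤m₂ 1≤k m₁≡ }) ,
  (λ { _ _ (j , m₁≡) _ _ _ →
         isGameChromaticIndex-blocks-≤ (suc j) (s≤s z≤n) (s≤s z≤n)
           (trans m₁≡ (odd-as-blocks j)) })
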